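{- If $\{A_n\}_{n\ge0}$ is an even sequence, then for all nonnegative integers $m$ and $n$, $$\sum_{k=0}^n\binom nk(-1)^kA_{k+m}=\sum_{k=0}^m\binom mk(-1)^kA_{k+n}.$$ If $\{A_n\}_{n\ge0}$ is an odd sequence, then for all nonnegative integers $m$ and $n$, $$\sum_{k=0}^n\binom nk(-1)^kA_{k+m}=-\sum_{k=0}^m\binom mk(-1)^kA_{k+n}.$$
   Context: A sequence $\{a_n\}_{n\ge0}$ of real (or complex) numbers is called an even sequence if $\sum_{k=0}^n\binom nk(-1)^ka_k=a_n$ for all $n=0,1,2,\ldots$, and an odd sequence if $\sum_{k=0}^n\binom nk(-1)^ka_k=-a_n$ for all $n=0,1,2,\ldots$. -}

module Defs where

open import Level using (Level)
open import Data.Nat using (ℕ; zero; suc; _+_)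
open import Data.Nat.Combinatorics using (_C_)
open import Algebra.Bundles using (CommutativeRing)
import Algebra.Definitions.RawMonoid as RM

-- Everything is parametrised by an arbitrary commutative ring R
-- (covers the paper's real and complex cases).
module Seq {c ℓ : Level} (R : CommutativeRing c ℓ) where
  open CommutativeRing R using (Carrier; _≈_; _*_; -_; 1#; +-rawMonoid)
  open CommutativeRing R using () renaming (_+_ to _⊕_)

  open RM +-rawMonoid using () renaming (_×_ to _·ℕ_) public

  sgn : ℕ → Carrier
  sgn zero    = 1#
  sgn (suc k) = - sgn k

  Σ≤ : ℕ → (ℕ → Carrier) → Carrier
  Σ≤ zero    f = f zero
  Σ≤ (suc n) f = Σ≤ n f ⊕ f (suc n)

  binomT : (ℕ → Carrier) → ℕ → Carrier
  binomT a n = Σ≤ n (λ k → (n C k) ·ℕ (sgn k * a k))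

  IsEven : (ℕ → Carrier) → Set ℓ
  IsEven a = ∀ n → binomT a n ≈ a n

  IsOdd : (ℕ → Carrier) → Set ℓ
  IsOdd a = ∀ n → binomT a n ≈ - a n

  shiftT : (ℕ → Carrier) → ℕ → ℕ → Carrier
  shiftT A m n = Σ≤ n (λ k → (n C k) ·ℕ (sgn k * A (k + m)))

module Submission where

-- Write T(m,n) = Σ_{k=0}^{n} C(n,k) (-1)^k A_{k+m}  (Defs: shiftT A m n).
-- The proof rests on one recurrence, obtained from Pascal's rule
-- C(n+1,k+1) = C(n,k) + C(n,k+1) by splitting the sum for T(m,n+1):
--
--     T(m, n+1) = T(m, n) - T(m+1, n).                                (★)
--
-- Any family S satisfying (★) is determined by its first row S(0,·) and
-- its first column S(·,0), and (★) is invariant under exchanging the two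
-- indices followed by multiplication with a fixed scalar ε.  Hence, by
-- induction on m: if S(0,n) = ε·S(n,0) for all n, then S(m,n) = ε·S(n,m)
-- for all m, n.  For S = T the first row is T(0,n) = Σ C(n,k)(-1)^k A_k
-- and the first column is T(n,0) = A_n, so an even sequence gives the
-- boundary condition with ε = 1 and an odd one with ε = -1.

open import Defs
open import Level using (Level)
open import Data.Nat using (ℕ; zero; suc)
import Data.Nat as ℕ
open import Data.Nat.Properties using (+-suc; n<1+n) renaming (+-identityʳ to ℕ-+-identityʳ)
open import Data.Nat.Combinatorics using (_C_; k>n⇒nCk≡0; nCk+nC[k+1]≡[n+1]C[k+1])
open import Data.Product using (_×_; _,_)
open import Algebra.Bundles using (CommutativeRing)
import Algebra.Properties.Monoid.Mult as MonoidMult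
import Algebra.Properties.Semiring.Mult as SemiringMult
import Algebra.Properties.AbelianGroup as AbelianGroupProperties
import Algebra.Properties.CommutativeSemigroup as CommutativeSemigroupProperties
import Algebra.Properties.Ring as RingProperties
import Relation.Binary.Reasoning.Setoid as SetoidReasoning
import Relation.Binary.PropositionalEquality as P

module SumLemmas {c ℓ : Level} (R : CommutativeRing c ℓ) where
  open CommutativeRing R hiding (zero)
  open Seq R
  open AbelianGroupProperties +-abelianGroup using (⁻¹-∙-comm; ⁻¹-anti-homo‿-; xyx⁻¹≈y)
  open CommutativeSemigroupProperties +-commutativeSemigroup using (interchange)
  open SemiringMult semiring using (×-comm-*)
  open RingProperties ring public using (-‿distribˡ-*; -1*x≈-x; x[y-z]≈xy-xz)
  open SetoidReasoning setoid

  solve-for-subtrahend : ∀ {a b c} → a ≈ b - c → c ≈ b - a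
  solve-for-subtrahend {a} {b} {c} a≈b-c = begin
    c             ≈⟨ xyx⁻¹≈y b c ⟨
    b + c - b     ≈⟨ +-assoc b c (- b) ⟩
    b + (c - b)   ≈⟨ +-congˡ (⁻¹-anti-homo‿- b c) ⟨
    b - (b - c)   ≈⟨ +-congˡ (-‿cong a≈b-c) ⟨
    b - a         ∎

  ×-neg : ∀ n x → n ·ℕ (- x) ≈ - (n ·ℕ x)
  ×-neg n x = begin
    n ·ℕ (- x)         ≈⟨ ×-congʳ n (-1*x≈-x x) ⟨
    n ·ℕ (- 1# * x)    ≈⟨ ×-comm-* n (- 1#) x ⟨
    - 1# * (n ·ℕ x)    ≈⟨ -1*x≈-x (n ·ℕ x) ⟩
    - (n ·ℕ x)         ∎
    where open MonoidMult +-monoid using (×-congʳ)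

  Σ-cong : ∀ n {f g : ℕ → Carrier} → (∀ k → f k ≈ g k) → Σ≤ n f ≈ Σ≤ n g
  Σ-cong zero    f≈g = f≈g zero
  Σ-cong (suc n) f≈g = +-cong (Σ-cong n f≈g) (f≈g (suc n))

  Σ-+ : ∀ n f g → Σ≤ n (λ k → f k + g k) ≈ Σ≤ n f + Σ≤ n g
  Σ-+ zero    f g = refl
  Σ-+ (suc n) f g = trans (+-congʳ (Σ-+ n f g)) (interchange _ _ _ _)

  Σ-neg : ∀ n f → Σ≤ n (λ k → - f k) ≈ - Σ≤ n f
  Σ-neg zero    f = refl
  Σ-neg (suc n) f = trans (+-congʳ (Σ-neg n f)) (⁻¹-∙-comm _ _)

  Σ-peel : ∀ n f → Σ≤ (suc n) f ≈ f 0 + Σ≤ n (λ k → f (suc k))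
  Σ-peel zero    f = refl
  Σ-peel (suc n) f = trans (+-congʳ (Σ-peel n f)) (+-assoc _ _ _)

module ShiftedSums {c ℓ : Level} (R : CommutativeRing c ℓ) (A : ℕ → CommutativeRing.Carrier R) where
  open CommutativeRing R hiding (zero)
  open Seq R
  open SumLemmas R
  open MonoidMult +-monoid using (×-congʳ; ×-congˡ; ×-homo-+)
  open SetoidReasoning setoid

  T : ℕ → ℕ → Carrier
  T = shiftT A

  term : ℕ → ℕ → Carrier
  term m k = sgn k * A (k ℕ.+ m)

  term-suc : ∀ m k → term m (suc k) ≈ - term (suc m) k
  term-suc m k = begin
    - sgn k * A (suc k ℕ.+ m)   ≈⟨ -‿distribˡ-* (sgn k) _ ⟨
    - (sgn k * A (suc k ℕ.+ m)) ≈⟨ -‿cong (*-congˡ (reflexive (P.cong A (P.sym (+-suc k m))))) ⟩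
    - term (suc m) k            ∎

  pascal : ∀ m n → T m (suc n) ≈ T m n - T (suc m) n
  pascal m n = begin
    T m (suc n)                             ≈⟨ Σ-peel n _ ⟩
    first + Σ≤ n (λ k → (suc n C suc k) ·ℕ term m (suc k))
      ≈⟨ +-congˡ (Σ-cong n split) ⟩
    first + Σ≤ n (λ k → (n C suc k) ·ℕ term m (suc k) + (n C k) ·ℕ term m (suc k))
      ≈⟨ +-congˡ (Σ-+ n _ _) ⟩
    first + (upper + lower)                 ≈⟨ +-assoc first upper lower ⟨
    (first + upper) + lower                 ≈⟨ +-cong upper-part lower-part ⟩
    T m n - T (suc m) n                     ∎
    where
    first = (suc n C 0) ·ℕ term m 0
    upper = Σ≤ n (λ k → (n C suc k) ·ℕ term m (suc k))
    lower = Σ≤ n (λ k → (n C k) ·ℕ term m (suc k))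

    split : ∀ k → (suc n C suc k) ·ℕ term m (suc k)
                ≈ (n C suc k) ·ℕ term m (suc k) + (n C k) ·ℕ term m (suc k)
    split k = begin
      (suc n C suc k) ·ℕ term m (suc k)
        ≈⟨ ×-congˡ (P.sym (nCk+nC[k+1]≡[n+1]C[k+1] n k)) ⟩
      (n C k ℕ.+ n C suc k) ·ℕ term m (suc k)
        ≈⟨ ×-homo-+ _ (n C k) (n C suc k) ⟩
      (n C k) ·ℕ term m (suc k) + (n C suc k) ·ℕ term m (suc k)
        ≈⟨ +-comm _ _ ⟩
      (n C suc k) ·ℕ term m (suc k) + (n C k) ·ℕ term m (suc k) ∎

    -- The C(n,k+1) terms reassemble T(m,n); the extra term C(n,n+1) vanishes.
    upper-part : first + upper ≈ T m n
    upper-part = begin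
      first + upper                          ≈⟨ Σ-peel n (λ k → (n C k) ·ℕ term m k) ⟨
      T m n + (n C suc n) ·ℕ term m (suc n)  ≈⟨ +-congˡ (×-congˡ (k>n⇒nCk≡0 (n<1+n n))) ⟩
      T m n + 0#                             ≈⟨ +-identityʳ _ ⟩
      T m n                                  ∎

    lower-part : lower ≈ - T (suc m) n
    lower-part = begin
      lower                                            ≈⟨ Σ-cong n (λ k → ×-congʳ (n C k) (term-suc m k)) ⟩
      Σ≤ n (λ k → (n C k) ·ℕ (- term (suc m) k))       ≈⟨ Σ-cong n (λ k → ×-neg (n C k) _) ⟩
      Σ≤ n (λ k → - ((n C k) ·ℕ term (suc m) k))       ≈⟨ Σ-neg n _ ⟩
      - T (suc m) n                                    ∎

  column₀ : ∀ n → T n 0 ≈ A n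
  column₀ n = trans (+-identityʳ _) (*-identityˡ _)

  row₀ : ∀ n → T 0 n ≈ binomT A n
  row₀ n = Σ-cong n (λ k → ×-congʳ (n C k) (*-congˡ (reflexive (P.cong A (ℕ-+-identityʳ k)))))

module Propagation {c ℓ : Level} (R : CommutativeRing c ℓ) where
  open CommutativeRing R hiding (zero)
  open SumLemmas R using (solve-for-subtrahend; x[y-z]≈xy-xz)
  open SetoidReasoning setoid

  SatisfiesPascal : (ℕ → ℕ → Carrier) → Set ℓ
  SatisfiesPascal S = ∀ m n → S m (suc n) ≈ S m n - S (suc m) n

  propagate : ∀ S ε → SatisfiesPascal S → (∀ n → S 0 n ≈ ε * S n 0) →
              ∀ m n → S m n ≈ ε * S n m
  propagate S ε pascal boundary zero    n = boundary n
  propagate S ε pascal boundary (suc m) n = begin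
    S (suc m) n                    ≈⟨ solve-for-subtrahend (pascal m n) ⟩
    S m n - S m (suc n)            ≈⟨ +-cong (propagate S ε pascal boundary m n)
                                             (-‿cong (propagate S ε pascal boundary m (suc n))) ⟩
    ε * S n m - ε * S (suc n) m    ≈⟨ x[y-z]≈xy-xz ε _ _ ⟨
    ε * (S n m - S (suc n) m)      ≈⟨ *-congˡ (pascal n m) ⟨
    ε * S n (suc m)                ∎

theorem2p11 : ∀ {c ℓ : Level} (R : CommutativeRing c ℓ) (A : ℕ → CommutativeRing.Carrier R) →
    (Seq.IsEven R A → ∀ m n →
    CommutativeRing._≈_ R (Seq.shiftT R A m n) (Seq.shiftT R A n m))
    × (Seq.IsOdd R A → ∀ m n →
    CommutativeRing._≈_ R (Seq.shiftT R A m n) (CommutativeRing.-_ R (Seq.shiftT R A n m)))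
theorem2p11 R A = even , odd
  where
  open CommutativeRing R
  open ShiftedSums R A using (T; pascal; row₀; column₀)
  open Propagation R using (propagate)
  open SumLemmas R using (-1*x≈-x)

  even : Seq.IsEven R A → ∀ m n → T m n ≈ T n m
  even isEven m n = trans (propagate T 1# pascal boundary m n) (*-identityˡ _)
    where
    boundary : ∀ n → T 0 n ≈ 1# * T n 0
    boundary n = trans (row₀ n) (trans (isEven n) (sym (trans (*-identityˡ _) (column₀ n))))

  odd : Seq.IsOdd R A → ∀ m n → T m n ≈ - T n m
  odd isOdd m n = trans (propagate T (- 1#) pascal boundary m n) (-1*x≈-x _)
    where
    boundary : ∀ n → T 0 n ≈ - 1# * T n 0
    boundary n = trans (row₀ n) (trans (isOdd n) (sym (trans (-1*x≈-x _) (-‿cong (column₀ n)))))
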